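{- Let $G$ be a graph on $n$ vertices with $3\leq n\leq 7$ and let $k$ be an integer with $2\leq k<n$. If $\psi_k(G)=n-k+1$, then $\psi_j(G)=n-j+1$ for all $j$ with $k<j\leq n$.
   Context: All graphs are finite and simple. For a graph $G=(V,E)$ and a positive integer $k$, a $k$-path vertex cover of $G$ is a set $S\subseteq V$ such that every path on $k$ vertices in $G$ contains at least one vertex of $S$, and $\psi_k(G)$ is the minimum cardinality of such a set. -}

module Defs where

open import Data.Nat using (ℕ; _≤_)
open import Data.Fin using (Fin)
open import Data.Fin.Subset using (Subset; _∈_; ∣_∣)
open import Data.List using (List; []; _∷_; length)
open import Data.List.Relation.Unary.Any using (Any)
open import Data.List.Relation.Unary.Unique.Propositional using (Unique)
open import Data.Product using (Σ; _×_)
open import Relation.Binary.PropositionalEquality using (_≡_)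
open import Relation.Nullary using (¬_; Dec)

record Graph (n : ℕ) : Set₁ where
  field
    Adj   : Fin n → Fin n → Set
    irrefl : ∀ {u} → ¬ Adj u u
    sym    : ∀ {u v} → Adj u v → Adj v u
    adj?   : ∀ u v → Dec (Adj u v)
open Graph public

data Consecutive {n : ℕ} (G : Graph n) : List (Fin n) → Set where
  []  : Consecutive G []
  [-] : ∀ {u} → Consecutive G (u ∷ [])
  _∷_ : ∀ {u v vs} → Adj G u v → Consecutive G (v ∷ vs) → Consecutive G (u ∷ v ∷ vs)

record IsPath {n : ℕ} (G : Graph n) (k : ℕ) (p : List (Fin n)) : Set where
  field
    len      : length p ≡ k
    distinct : Unique p
    adjacent : Consecutive G p

IsKPathVertexCover : ∀ {n} → Graph n → ℕ → Subset n → Set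
IsKPathVertexCover G k S = ∀ p → IsPath G k p → Any (λ v → v ∈ S) p

ψ≡ : ∀ {n} → Graph n → ℕ → ℕ → Set
ψ≡ G k m =
  Σ _ (λ S → IsKPathVertexCover G k S × ∣ S ∣ ≡ m)
  × (∀ S → IsKPathVertexCover G k S → m ≤ ∣ S ∣)

module Submission where

-- For 1 ≤ j ≤ n, ψ_j(G) = n − j + 1 holds exactly when every set of
-- j vertices of G contains a path on j vertices (a j-set "is traceable"):
-- a smaller cover would leave j uncovered vertices, and conversely the
-- complement of any (j − 1)-set is a cover.  So the theorem says that
-- traceability of all k-sets propagates to all larger sets, and it is
-- enough to go from m-sets to (m + 1)-sets.  Relabelling an (m + 1)-set
-- along a path of it minus one vertex, this becomes a statement about
-- Boolean graphs on Fin (m + 1) whose vertex-deleted subgraphs all have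
-- Hamiltonian paths; for 3 ≤ m + 1 ≤ 7 it is settled by a finite case
-- analysis on the unknown edges, recorded as checkable certificates.

open import Data.Bool using (Bool; true; false; _∧_; _∨_; not; if_then_else_)
open import Data.Bool.Properties using (∧-conicalˡ; ∧-conicalʳ; ∧-identityʳ)
open import Data.Empty using (⊥; ⊥-elim)
open import Data.Fin using (Fin; zero; suc; #_)
open import Data.Fin.Properties using (_≟_)
open import Data.Fin.Subset using (Subset; ∣_∣) renaming (_∈_ to _∈ˢ_)
open import Data.Fin.Subset.Properties using () renaming (_∈?_ to _∈ˢ?_)
open import Data.List using (List; []; _∷_; length; map; tabulate; lookup)
open import Data.List.Properties using (length-map; map-tabulate; tabulate-lookup)
open import Data.List.Membership.Propositional using (_∈_)
open import Data.List.Membership.Propositional.Properties using (∈-lookup)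
open import Data.List.Relation.Unary.All as All using (All; []; _∷_)
open import Data.List.Relation.Unary.AllPairs using ([]; _∷_)
import Data.List.Relation.Unary.All.Properties as Allₚ
open import Data.List.Relation.Unary.Any as Any using (any?)
open import Data.List.Relation.Unary.Any.Properties using (lookup-index)
open import Data.List.Relation.Unary.Linked as Linked using (Linked; []; [-]; _∷_)
import Data.List.Relation.Unary.Linked.Properties as Linkedₚ
open import Data.List.Relation.Unary.Unique.Propositional using (Unique)
import Data.List.Relation.Unary.Unique.Propositional.Properties as Uniqueₚ
open import Data.Maybe using (Maybe; just; nothing; fromMaybe)
open import Data.Nat
  using (ℕ; zero; suc; pred; _+_; _∸_; _≤_; _<_; _≤′_; ≤′-refl; ≤′-step; z≤n; s≤s; _≤?_)
open import Data.Nat.Properties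
  using (≤-trans; ≤-pred; +-suc; <⇒≤; ≰⇒>; 1+n≰n; m<1+n⇒m≤n; +-comm; suc-injective;
         m+n∸m≡n; +-∸-assoc; m∸[m∸n]≡n; ∸-monoʳ-≤; ≤⇒≤′; ≤′⇒≤)
open import Data.Product using (Σ; _×_; _,_; proj₁; proj₂)
import Data.Vec as Vec
open import Data.Vec.Properties using (tabulate∘lookup; []=⇒lookup; lookup⇒[]=; lookup∘tabulate)
open import Function using (_∘_)
open import Relation.Nullary using (¬_; yes; no; does)
open import Relation.Nullary.Decidable using (dec-true; dec-false)
open import Relation.Binary.PropositionalEquality
  using (_≡_; _≢_; refl; sym; trans; cong; cong₂; subst; subst₂)

open import Defs hiding (sym)

-- Vertex sets of Fin N are Boolean predicates, so that membership and
-- cardinality compute; this is what makes the certificates checkable.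
Pred𝔹 : ℕ → Set
Pred𝔹 N = Fin N → Bool

_∈ᵇ_ : ∀ {N} → Fin N → Pred𝔹 N → Set
x ∈ᵇ R = R x ≡ true

full : ∀ {N} → Pred𝔹 N
full _ = true

false≢true : false ≢ true
false≢true ()

∧-intro : ∀ {x y} → x ≡ true → y ≡ true → x ∧ y ≡ true
∧-intro refl refl = refl

remove : ∀ {N} → Pred𝔹 N → Fin N → Pred𝔹 N
remove R r x = R x ∧ not (does (x ≟ r))

remove-⊆ : ∀ {N} {R : Pred𝔹 N} {r x} → x ∈ᵇ remove R r → x ∈ᵇ R
remove-⊆ {R = R} {x = x} x∈R-r = ∧-conicalˡ (R x) _ x∈R-r

remove-≢ : ∀ {N} {R : Pred𝔹 N} {r x} → x ∈ᵇ remove R r → r ≢ x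
remove-≢ {R = R} {r} r∈R-r refl with r ≟ r | ∧-conicalʳ (R r) _ r∈R-r
... | yes _   | ()
... | no r≢r  | _ = r≢r refl

remove-intro : ∀ {N} {R : Pred𝔹 N} {r x} → x ∈ᵇ R → r ≢ x → x ∈ᵇ remove R r
remove-intro {r = r} {x} x∈R r≢x rewrite x∈R | dec-false (x ≟ r) (r≢x ∘ sym) = refl

tail-in-remove : ∀ {N} {R : Pred𝔹 N} {r q} →
                 All (r ≢_) q → All (_∈ᵇ R) q → All (_∈ᵇ remove R r) q
tail-in-remove {R = R} r≢q q⊆R =
  All.zipWith (λ (x∈R , r≢x) → remove-intro {R = R} x∈R r≢x) (q⊆R , r≢q)

count : ∀ {N} → Pred𝔹 N → ℕ
count {zero}  R = 0
count {suc N} R = (if R zero then 1 else 0) + count (R ∘ suc)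

count-cong : ∀ {N} {R S : Pred𝔹 N} → (∀ x → R x ≡ S x) → count R ≡ count S
count-cong {zero}          _   = refl
count-cong {suc N} {R} {S} R≗S rewrite R≗S zero = cong (_ +_) (count-cong (R≗S ∘ suc))

count-full : ∀ N → count (full {N}) ≡ N
count-full zero    = refl
count-full (suc N) = cong suc (count-full N)

count-remove : ∀ {N} (R : Pred𝔹 N) {x} → x ∈ᵇ R → suc (count (remove R x)) ≡ count R
count-remove {suc N} R {zero} x∈R rewrite x∈R =
  cong suc (count-cong (λ y → ∧-identityʳ (R (suc y))))
count-remove {suc N} R {suc x} x∈R with R zero
... | true  = cong suc (count-remove (R ∘ suc) x∈R)
... | false = count-remove (R ∘ suc) x∈R

count-complement : ∀ {N} (R : Pred𝔹 N) → count R + count (not ∘ R) ≡ N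
count-complement {zero}  R = refl
count-complement {suc N} R with R zero
... | true  = cong suc (count-complement (R ∘ suc))
... | false = trans (+-suc (count (R ∘ suc)) _) (cong suc (count-complement (R ∘ suc)))

count-not : ∀ {N} (R : Pred𝔹 N) → count (not ∘ R) ≡ N ∸ count R
count-not {N} R = trans (sym (m+n∸m≡n (count R) _)) (cong (_∸ count R) (count-complement R))

length≤count : ∀ {N} {R : Pred𝔹 N} {p} → Unique p → All (_∈ᵇ R) p → length p ≤ count R
length≤count {p = []}    _             _            = z≤n
length≤count {R = R} {x ∷ p} (x≢p ∷ distinct) (x∈R ∷ p⊆R) =
  subst (suc (length p) ≤_) (count-remove R x∈R)
        (s≤s (length≤count distinct (tail-in-remove x≢p p⊆R)))

_◂_ : ∀ {N} → Bool → Pred𝔹 N → Pred𝔹 (suc N)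
(b ◂ R) zero    = b
(b ◂ R) (suc x) = R x

◂-⊆ : ∀ {N} {R : Pred𝔹 (suc N)} {U : Pred𝔹 N} {b} → (b ≡ true → zero ∈ᵇ R) →
      (∀ {x} → x ∈ᵇ U → suc x ∈ᵇ R) → ∀ {x} → x ∈ᵇ (b ◂ U) → x ∈ᵇ R
◂-⊆ b⇒R0 _    {zero}  b≡true = b⇒R0 b≡true
◂-⊆ _    U⊆R {suc x} x∈U    = U⊆R x∈U

subsetOfSize : ∀ {N} (R : Pred𝔹 N) j → j ≤ count R →
               Σ (Pred𝔹 N) λ U → (∀ {x} → x ∈ᵇ U → x ∈ᵇ R) × count U ≡ j
subsetOfSize {zero}  R zero    z≤n = R , (λ {x} x∈R → x∈R) , refl
subsetOfSize {suc N} R zero    _   =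
  let U , U⊆R , |U| = subsetOfSize (R ∘ suc) zero z≤n
  in false ◂ U , ◂-⊆ {R = R} {U} {false} (λ ()) U⊆R , |U|
subsetOfSize {suc N} R (suc j) j<|R| with R zero in R0
... | true  = let U , U⊆R , |U| = subsetOfSize (R ∘ suc) j (≤-pred j<|R|)
              in true ◂ U , ◂-⊆ {R = R} {U} {true} (λ _ → R0) U⊆R , cong suc |U|
... | false = let U , U⊆R , |U| = subsetOfSize (R ∘ suc) (suc j) j<|R|
              in false ◂ U , ◂-⊆ {R = R} {U} {false} (λ ()) U⊆R , |U|

member : ∀ {N} (R : Pred𝔹 N) → 0 < count R → Σ (Fin N) (_∈ᵇ R)
member {suc N} R 0<|R| with R zero in R0
... | true  = zero , R0
... | false = let x , x∈R = member (R ∘ suc) 0<|R| in suc x , x∈R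

BAdj : ℕ → Set
BAdj N = Fin N → Fin N → Bool

Edge : ∀ {N} → BAdj N → Fin N → Fin N → Set
Edge A u v = A u v ≡ true

Symmetric : ∀ {N} → BAdj N → Set
Symmetric A = ∀ i j → A i j ≡ A j i

record BPath {N} (A : BAdj N) (R : Pred𝔹 N) (L : ℕ) (p : List (Fin N)) : Set where
  constructor bpath
  field
    len      : length p ≡ L
    distinct : Unique p
    inside   : All (_∈ᵇ R) p
    linked   : Linked (Edge A) p

prepend : ∀ {N} {A : BAdj N} {R r q L} → r ∈ᵇ R → BPath A (remove R r) L q →
          Linked (Edge A) (r ∷ q) → BPath A R (suc L) (r ∷ q)
prepend {R = R} r∈R (bpath len distinct inside _) link =
  bpath (cong suc len) (All.map (remove-≢ {R = R}) inside ∷ distinct)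
        (r∈R ∷ All.map (remove-⊆ {R = R}) inside) link

someFin : ∀ {N} → (Fin N → Bool) → Bool
someFin {zero}  f = false
someFin {suc N} f = f zero ∨ someFin (f ∘ suc)

someFin-intro : ∀ {N} (f : Fin N → Bool) x → f x ≡ true → someFin f ≡ true
someFin-intro {suc N} f zero    fx rewrite fx = refl
someFin-intro {suc N} f (suc x) fx with f zero
... | true  = refl
... | false = someFin-intro (f ∘ suc) x fx

someFin-elim : ∀ {N} (f : Fin N → Bool) → someFin f ≡ true → Σ (Fin N) λ x → f x ≡ true
someFin-elim {suc N} f some with f zero in f0
... | true  = zero , f0
... | false = let x , fx = someFin-elim (f ∘ suc) some in suc x , fx

extends : ∀ {N} → BAdj N → Fin N → Pred𝔹 N → ℕ → Bool
extends A u R zero    = true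
extends A u R (suc L) = someFin λ r → R r ∧ (A u r ∧ extends A r (remove R r) L)

hasPath : ∀ {N} → BAdj N → Pred𝔹 N → ℕ → Bool
hasPath A R zero    = true
hasPath A R (suc L) = someFin λ r → R r ∧ extends A r (remove R r) L

extends-sound : ∀ {N} (A : BAdj N) u R L → extends A u R L ≡ true →
                Σ (List (Fin N)) λ q → BPath A R L q × Linked (Edge A) (u ∷ q)
extends-sound A u R zero    _  = [] , bpath refl [] [] [] , [-]
extends-sound A u R (suc L) ok =
  let r , found    = someFin-elim _ ok
      r∈R          = ∧-conicalˡ (R r) _ found
      rest         = ∧-conicalʳ (R r) _ found
      u~r          = ∧-conicalˡ (A u r) _ rest
      q , path , r~q = extends-sound A r (remove R r) L (∧-conicalʳ (A u r) _ rest)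
  in r ∷ q , prepend r∈R path r~q , u~r ∷ r~q

hasPath-sound : ∀ {N} (A : BAdj N) R L → hasPath A R L ≡ true → Σ (List (Fin N)) (BPath A R L)
hasPath-sound A R zero    _  = [] , bpath refl [] [] []
hasPath-sound A R (suc L) ok =
  let r , found      = someFin-elim _ ok
      q , path , r~q = extends-sound A r (remove R r) L (∧-conicalʳ (R r) _ found)
  in r ∷ q , prepend (∧-conicalˡ (R r) _ found) path r~q

extends-complete : ∀ {N} (A : BAdj N) u R {L q} → BPath A R L q → Linked (Edge A) (u ∷ q) →
                   extends A u R L ≡ true
extends-complete A u R (bpath refl [] [] []) [-] = refl
extends-complete A u R {q = r ∷ q} (bpath refl (r≢q ∷ distinct) (r∈R ∷ q⊆R) link) (u~r ∷ r~q) =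
  someFin-intro (λ x → R x ∧ (A u x ∧ extends A x (remove R x) (length q))) r
    (∧-intro r∈R (∧-intro u~r (extends-complete A r (remove R r)
      (bpath refl distinct (tail-in-remove r≢q q⊆R) (Linked.tail link)) r~q)))

hasPath-complete : ∀ {N} (A : BAdj N) R {L p} → BPath A R L p → hasPath A R L ≡ true
hasPath-complete A R (bpath refl [] [] []) = refl
hasPath-complete A R {p = r ∷ q} (bpath refl (r≢q ∷ distinct) (r∈R ∷ q⊆R) link) =
  someFin-intro (λ x → R x ∧ extends A x (remove R x) (length q)) r
    (∧-intro r∈R (extends-complete A r (remove R r)
      (bpath refl distinct (tail-in-remove r≢q q⊆R) (Linked.tail link)) link))

hasPath-mono : ∀ {N} {A A′ : BAdj N} → (∀ {u v} → Edge A u v → Edge A′ u v) →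
               ∀ R L → hasPath A R L ≡ true → hasPath A′ R L ≡ true
hasPath-mono {A = A} {A′} A⊆A′ R L ok =
  let p , bpath len distinct inside link = hasPath-sound A R L ok
  in hasPath-complete A′ R (bpath len distinct inside (Linked.map A⊆A′ link))

-- A partial assignment fixes the status (edge or non-edge) of some
-- unordered pairs of vertices.
Assignment : ℕ → Set
Assignment N = List (Fin N × Fin N × Bool)

_==_ : ∀ {N} → Fin N → Fin N → Bool
i == j = does (i ≟ j)

==-sound : ∀ {N} {i j : Fin N} → i == j ≡ true → i ≡ j
==-sound {i = i} {j} i==j with i ≟ j | i==j
... | yes i≡j | _ = i≡j
... | no _    | ()

samePair : ∀ {N} → Fin N → Fin N → Fin N → Fin N → Bool
samePair a c i j = (a == i ∧ c == j) ∨ (a == j ∧ c == i)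

samePair-sound : ∀ {N} {A : BAdj N} → Symmetric A → ∀ {a c i j} →
                 samePair a c i j ≡ true → A a c ≡ A i j
samePair-sound {A = A} sym-A {a} {c} {i} {j} same with a == i ∧ c == j in direct
... | true  = cong₂ A (==-sound (∧-conicalˡ (a == i) _ direct))
                     (==-sound (∧-conicalʳ (a == i) _ direct))
... | false = trans (cong₂ A (==-sound (∧-conicalˡ (a == j) _ same))
                             (==-sound (∧-conicalʳ (a == j) _ same)))
                    (sym-A j i)

lookupPair : ∀ {N} → Assignment N → Fin N → Fin N → Maybe Bool
lookupPair []                i j = nothing
lookupPair ((a , c , x) ∷ P) i j = if samePair a c i j then just x else lookupPair P i j

pessimistic optimistic : ∀ {N} → Assignment N → BAdj N
pessimistic P i j = fromMaybe false (lookupPair P i j)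
optimistic  P i j = fromMaybe true  (lookupPair P i j)

Agrees : ∀ {N} → BAdj N → Fin N × Fin N × Bool → Set
Agrees A (a , c , x) = A a c ≡ x

Consistent : ∀ {N} → BAdj N → Assignment N → Set
Consistent A P = All (Agrees A) P

lookupPair-sound : ∀ {N} {A : BAdj N} {P i j x} → Symmetric A → Consistent A P →
                   lookupPair P i j ≡ just x → A i j ≡ x
lookupPair-sound {P = (a , c , y) ∷ P} {i} {j} sym-A (agrees ∷ consistent) found
  with samePair a c i j in same
... | true  with refl ← found = trans (sym (samePair-sound sym-A same)) agrees
... | false = lookupPair-sound sym-A consistent found

pessimistic-sound : ∀ {N} {A : BAdj N} {P} → Symmetric A → Consistent A P →
                    ∀ {i j} → Edge (pessimistic P) i j → Edge A i j
pessimistic-sound {P = P} sym-A consistent {i} {j} edge with lookupPair P i j in found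
... | just x  = trans (lookupPair-sound sym-A consistent found) edge
... | nothing = ⊥-elim (false≢true edge)

optimistic-complete : ∀ {N} {A : BAdj N} {P} → Symmetric A → Consistent A P →
                      ∀ {i j} → Edge A i j → Edge (optimistic P) i j
optimistic-complete {P = P} sym-A consistent {i} {j} edge with lookupPair P i j in found
... | just x  = trans (sym (lookupPair-sound sym-A consistent found)) edge
... | nothing = refl

-- A certificate is a case split on pairs of vertices; at every leaf either
-- the pessimistic completion has a Hamiltonian path, or the optimistic
-- completion minus some vertex v has no path through all remaining vertices.
data Certificate (N : ℕ) : Set where
  leafPath   : Certificate N
  leafVertex : Fin N → Certificate N
  split      : Fin N → Fin N → Certificate N → Certificate N → Certificate N

check : ∀ {N} → Assignment N → Certificate N → Bool
check {N} P leafPath        = hasPath (pessimistic P) full N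
check {N} P (leafVertex v)  = not (hasPath (optimistic P) (remove full v) (pred N))
check     P (split i j c d) = check ((i , j , true) ∷ P) c ∧ check ((i , j , false) ∷ P) d

check-sound : ∀ {N} {A : BAdj N} → Symmetric A →
              (∀ v → hasPath A (remove full v) (pred N) ≡ true) →
              ∀ P c → Consistent A P → check P c ≡ true → hasPath A full N ≡ true
check-sound {N} sym-A _ _ leafPath consistent ok =
  hasPath-mono (pessimistic-sound sym-A consistent) full N ok
check-sound {N} sym-A deletions _ (leafVertex v) consistent ok =
  ⊥-elim (false≢true (trans (sym (cong not traceable)) ok))
  where
  traceable : hasPath _ (remove full v) (pred N) ≡ true
  traceable = hasPath-mono (optimistic-complete sym-A consistent) (remove full v) (pred N) (deletions v)
check-sound {A = A} sym-A deletions P (split i j c d) consistent ok with A i j in edge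
... | true  = check-sound sym-A deletions _ c (edge ∷ consistent) (∧-conicalˡ (check _ c) _ ok)
... | false = check-sound sym-A deletions _ d (edge ∷ consistent) (∧-conicalʳ (check _ c) _ ok)

spine : ∀ m → List (Fin m)
spine zero    = []
spine (suc m) = tabulate suc

pathAssignment : ∀ {N} → List (Fin N) → Assignment N
pathAssignment []           = []
pathAssignment (x ∷ [])     = []
pathAssignment (x ∷ y ∷ xs) = (x , y , true) ∷ pathAssignment (y ∷ xs)

linked⇒consistent : ∀ {N} {A : BAdj N} {xs} → Linked (Edge A) xs → Consistent A (pathAssignment xs)
linked⇒consistent []           = []
linked⇒consistent [-]          = []
linked⇒consistent (edge ∷ rest) = edge ∷ linked⇒consistent rest

-- certificates for the orders 3, …, 7, found by computer search
certificate : ∀ m → 3 ≤ m → m ≤ 7 → Certificate m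
certificate 3 _ _ =
  split (# 2) (# 0) leafPath (leafVertex (# 1))
certificate 4 _ _ =
  split (# 3) (# 0) leafPath (split (# 1) (# 0) leafPath (leafVertex (# 2)))
certificate 5 _ _ =
  split (# 4) (# 0)
    leafPath
    (split (# 1) (# 0)
      leafPath
      (split (# 4) (# 1)
        (split (# 3) (# 0) leafPath (leafVertex (# 2)))
        (leafVertex (# 3))))
certificate 6 _ _ =
  split (# 5) (# 0)
    leafPath
    (split (# 1) (# 0)
      leafPath
      (split (# 5) (# 3)
        (split (# 4) (# 0)
          leafPath
          (split (# 3) (# 0)
            (split (# 2) (# 0) leafPath (leafVertex (# 3)))
            (leafVertex (# 2))))
        (split (# 5) (# 2)
          (split (# 3) (# 0)
            leafPath
            (split (# 5) (# 1)
              (split (# 4) (# 0) leafPath (leafVertex (# 2)))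
              (leafVertex (# 4))))
          (split (# 5) (# 1)
            (split (# 4) (# 0) leafPath (split (# 3) (# 0) leafPath (leafVertex (# 2))))
            (leafVertex (# 4))))))
certificate 7 _ _ =
  split (# 6) (# 0)
    leafPath
    (split (# 1) (# 0)
      leafPath
      (split (# 6) (# 4)
        (split (# 5) (# 0)
          leafPath
          (split (# 6) (# 3)
            (split (# 4) (# 0)
              leafPath
              (split (# 3) (# 0)
                (split (# 2) (# 0) leafPath (leafVertex (# 3)))
                (leafVertex (# 2))))
            (split (# 6) (# 2)
              (split (# 3) (# 0)
                leafPath
                (split (# 4) (# 0)
                  (split (# 6) (# 1)
                    leafPath
                    (split (# 3) (# 1) leafPath (leafVertex (# 5))))
                  (leafVertex (# 2))))
              (split (# 6) (# 1)
                (split (# 4) (# 0)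
                  leafPath
                  (split (# 3) (# 0) leafPath (leafVertex (# 2))))
                (split (# 5) (# 3)
                  (split (# 4) (# 0)
                    leafPath
                    (split (# 3) (# 0)
                      (split (# 2) (# 0) leafPath (leafVertex (# 3)))
                      (leafVertex (# 2))))
                  (split (# 5) (# 2)
                    (split (# 3) (# 0)
                      leafPath
                      (split (# 5) (# 1)
                        (split (# 4) (# 0) leafPath (leafVertex (# 2)))
                        (leafVertex (# 4))))
                    (split (# 5) (# 1)
                      (split (# 4) (# 0)
                        leafPath
                        (split (# 3) (# 0) leafPath (leafVertex (# 2))))
                      (leafVertex (# 4)))))))))
        (split (# 6) (# 3)
          (split (# 4) (# 0)
            leafPath
            (split (# 6) (# 2)
              (split (# 5) (# 0) leafPath (split (# 3) (# 0) leafPath (leafVertex (# 2))))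
              (split (# 6) (# 1)
                (split (# 5) (# 0)
                  leafPath
                  (split (# 3) (# 0) leafPath (leafVertex (# 2))))
                (split (# 4) (# 1)
                  (split (# 2) (# 0) leafPath (leafVertex (# 5)))
                  (leafVertex (# 5))))))
          (split (# 6) (# 2)
            (split (# 3) (# 0)
              leafPath
              (split (# 6) (# 1)
                (split (# 5) (# 0)
                  leafPath
                  (split (# 4) (# 0) leafPath (leafVertex (# 2))))
                (split (# 4) (# 0)
                  (split (# 3) (# 1) leafPath (leafVertex (# 5)))
                  (leafVertex (# 5)))))
            (split (# 6) (# 1)
              (split (# 5) (# 0)
                leafPath
                (split (# 4) (# 0)
                  leafPath
                  (split (# 3) (# 0) leafPath (leafVertex (# 2)))))
              (leafVertex (# 5)))))))
certificate 1 (s≤s ()) _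
certificate 2 (s≤s (s≤s ())) _
certificate (suc (suc (suc (suc (suc (suc (suc (suc _)))))))) _
  (s≤s (s≤s (s≤s (s≤s (s≤s (s≤s (s≤s ())))))))

certificate-valid : ∀ m (3≤m : 3 ≤ m) (m≤7 : m ≤ 7) →
                    check (pathAssignment (spine m)) (certificate m 3≤m m≤7) ≡ true
certificate-valid 3 _ _ = refl
certificate-valid 4 _ _ = refl
certificate-valid 5 _ _ = refl
certificate-valid 6 _ _ = refl
certificate-valid 7 _ _ = refl
certificate-valid 1 (s≤s ()) _
certificate-valid 2 (s≤s (s≤s ())) _
certificate-valid (suc (suc (suc (suc (suc (suc (suc (suc _)))))))) _
  (s≤s (s≤s (s≤s (s≤s (s≤s (s≤s (s≤s ())))))))

-- The spine hypothesis is a normalisation of the labelling (any such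
-- graph can be relabelled to satisfy it) that keeps the certificates small.
smallOrder : ∀ m → 3 ≤ m → m ≤ 7 → (A : BAdj m) → Symmetric A → Linked (Edge A) (spine m) →
             (∀ v → hasPath A (remove full v) (pred m) ≡ true) → hasPath A full m ≡ true
smallOrder m 3≤m m≤7 A sym-A spine-path deletions =
  check-sound sym-A deletions (pathAssignment (spine m)) (certificate m 3≤m m≤7)
              (linked⇒consistent spine-path) (certificate-valid m 3≤m m≤7)

lookup-injective : ∀ {a} {X : Set a} {xs : List X} → Unique xs →
                   ∀ {i j} → lookup xs i ≡ lookup xs j → i ≡ j
lookup-injective {xs = x ∷ xs} _           {zero}  {zero}  _  = refl
lookup-injective {xs = x ∷ xs} (x≢xs ∷ _) {zero}  {suc j} x≡ = ⊥-elim (All.lookup x≢xs (∈-lookup j) x≡)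
lookup-injective {xs = x ∷ xs} (x≢xs ∷ _) {suc i} {zero}  ≡x = ⊥-elim (All.lookup x≢xs (∈-lookup i) (sym ≡x))
lookup-injective {xs = x ∷ xs} (_ ∷ u)     {suc i} {suc j} eq = cong suc (lookup-injective u eq)

module Relabel {N} (B : BAdj N) (U : Pred𝔹 N) (w : List (Fin N)) (w-distinct : Unique w)
               (w⊆U : All (_∈ᵇ U) w) (|U|≡|w| : count U ≡ length w) where

  label : Fin (length w) → Fin N
  label = lookup w

  A : BAdj (length w)
  A i j = B (label i) (label j)

  label∈U : ∀ i → label i ∈ᵇ U
  label∈U i = All.lookup w⊆U (∈-lookup i)

  -- w lists all of U: one more member would exceed count U
  U⊆w : ∀ {x} → x ∈ᵇ U → x ∈ w
  U⊆w {x} x∈U with any? (x ≟_) w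
  ... | yes x∈w = x∈w
  ... | no  x∉w = ⊥-elim (1+n≰n (subst (suc (length w) ≤_) |U|≡|w|
                    (length≤count (Allₚ.¬Any⇒All¬ w x∉w ∷ w-distinct) (x∈U ∷ w⊆U))))

  unlabel : ∀ {p} → All (_∈ᵇ U) p → List (Fin (length w))
  unlabel []          = []
  unlabel (x∈U ∷ p⊆U) = Any.index (U⊆w x∈U) ∷ unlabel p⊆U

  label-unlabel : ∀ {p} (p⊆U : All (_∈ᵇ U) p) → map label (unlabel p⊆U) ≡ p
  label-unlabel []          = refl
  label-unlabel (x∈U ∷ p⊆U) = cong₂ _∷_ (sym (lookup-index (U⊆w x∈U))) (label-unlabel p⊆U)

  push : ∀ {L r} → BPath A full L r → BPath B U L (map label r)
  push {r = r} (bpath len distinct _ link) =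
    bpath (trans (length-map label r) len) (Uniqueₚ.map⁺ (lookup-injective w-distinct) distinct)
          (Allₚ.map⁺ (All.universal label∈U r)) (Linkedₚ.map⁺ link)

  pull : ∀ {i L p} → BPath B (remove U (label i)) L p → Σ (List (Fin (length w))) (BPath A (remove full i) L)
  pull {i} {L} {p} (bpath len distinct inside link) =
    r , bpath (trans (sym (length-map label r)) (trans (cong length r↦p) len))
              (Uniqueₚ.map⁻ (subst Unique (sym r↦p) distinct))
              (All.map avoids-i (Allₚ.map⁻ (subst (All (_∈ᵇ remove U (label i))) (sym r↦p) inside)))
              (Linkedₚ.map⁻ (subst (Linked (Edge B)) (sym r↦p) link))
    where
    p⊆U : All (_∈ᵇ U) p
    p⊆U = All.map (remove-⊆ {R = U}) inside
    r : List (Fin (length w))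
    r = unlabel p⊆U
    r↦p : map label r ≡ p
    r↦p = label-unlabel p⊆U
    avoids-i : ∀ {k} → label k ∈ᵇ remove U (label i) → k ∈ᵇ remove full i
    avoids-i {k} h = remove-intro {R = full} refl (λ i≡k → remove-≢ {R = U} h (cong label i≡k))

AllSetsTraceable : ∀ {N} → BAdj N → ℕ → Set
AllSetsTraceable B j = ∀ U → count U ≡ j → hasPath B U j ≡ true

-- The step m → m + 1: given an (m + 1)-set U, pick v ∈ U and a path q
-- through U ∖ v; relabelling U along v ∷ q puts q on the spine, and the
-- vertex-deleted subgraphs are traceable m-sets, so the small-order lemma
-- yields a Hamiltonian path of U.
traceable-step : ∀ {N} {B : BAdj N} → Symmetric B → ∀ m → 2 ≤ m → m < 7 →
                 AllSetsTraceable B m → AllSetsTraceable B (suc m)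
traceable-step {N} {B} sym-B m 2≤m m<7 traceableₘ U |U|≡1+m =
  subst (λ l → hasPath B U (suc l) ≡ true) len
    (hasPath-complete B U (push (proj₂ (hasPath-sound A full (length w) hamiltonian))))
  where
  pathWithout : ∀ {x} → x ∈ᵇ U → Σ (List (Fin N)) (BPath B (remove U x) m)
  pathWithout x∈U = hasPath-sound B _ m (traceableₘ _ (suc-injective (trans (count-remove U x∈U) |U|≡1+m)))

  picked : Σ (Fin N) (_∈ᵇ U)
  picked = member U (subst (0 <_) (sym |U|≡1+m) (s≤s z≤n))
  v : Fin N
  v = proj₁ picked
  v∈U : v ∈ᵇ U
  v∈U = proj₂ picked
  q : List (Fin N)
  q = proj₁ (pathWithout v∈U)
  open BPath (proj₂ (pathWithout v∈U))
  w : List (Fin N)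
  w = v ∷ q

  open Relabel B U w (All.map (remove-≢ {R = U}) inside ∷ distinct)
                     (v∈U ∷ All.map (remove-⊆ {R = U}) inside) (trans |U|≡1+m (cong suc (sym len)))

  spine-linked : Linked (Edge A) (spine (length w))
  spine-linked = Linkedₚ.map⁻ (subst (Linked (Edge B)) (sym labels-spine) linked)
    where
    labels-spine : map label (tabulate suc) ≡ q
    labels-spine = trans (map-tabulate suc label) (tabulate-lookup q)

  deletions : ∀ i → hasPath A (remove full i) (length q) ≡ true
  deletions i = subst (λ l → hasPath A (remove full i) l ≡ true) (sym len)
    (hasPath-complete A _ (proj₂ (pull {i} (proj₂ (pathWithout (label∈U i))))))

  hamiltonian : hasPath A full (length w) ≡ true
  hamiltonian = smallOrder (length w) (subst (λ l → 3 ≤ suc l) (sym len) (s≤s 2≤m))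
                  (subst (λ l → suc l ≤ 7) (sym len) m<7) A (λ i j → sym-B (label i) (label j))
                  spine-linked deletions

traceable-upward : ∀ {N} {B : BAdj N} → Symmetric B → ∀ {k j} → 2 ≤ k → k ≤′ j → j ≤ 7 →
                   AllSetsTraceable B k → AllSetsTraceable B j
traceable-upward sym-B 2≤k ≤′-refl _ traceableₖ = traceableₖ
traceable-upward sym-B 2≤k (≤′-step {j} k≤′j) j<7 traceableₖ =
  traceable-step sym-B j (≤-trans 2≤k (≤′⇒≤ k≤′j)) j<7
    (traceable-upward sym-B 2≤k k≤′j (<⇒≤ j<7) traceableₖ)

adjacency : ∀ {n} → Graph n → BAdj n
adjacency G u v = does (adj? G u v)

adjacency-sym : ∀ {n} (G : Graph n) → Symmetric (adjacency G)
adjacency-sym G u v with adj? G u v | adj? G v u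
... | yes _   | yes _   = refl
... | no _    | no _    = refl
... | yes u~v | no v≁u  = ⊥-elim (v≁u (Graph.sym G u~v))
... | no u≁v  | yes v~u = ⊥-elim (u≁v (Graph.sym G v~u))

edge⇒adj : ∀ {n} (G : Graph n) {u v} → Edge (adjacency G) u v → Adj G u v
edge⇒adj G {u} {v} edge with adj? G u v | edge
... | yes u~v | _ = u~v
... | no _    | ()

linked⇒consecutive : ∀ {n} (G : Graph n) {p} → Linked (Edge (adjacency G)) p → Consecutive G p
linked⇒consecutive G []            = []
linked⇒consecutive G [-]           = [-]
linked⇒consecutive G (edge ∷ link) = edge⇒adj G edge ∷ linked⇒consecutive G link

consecutive⇒linked : ∀ {n} (G : Graph n) {p} → Consecutive G p → Linked (Edge (adjacency G)) p
consecutive⇒linked G []          = []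
consecutive⇒linked G [-]         = [-]
consecutive⇒linked G (u~v ∷ rest) = dec-true (adj? G _ _) u~v ∷ consecutive⇒linked G rest

isPath⇒bpath : ∀ {n} (G : Graph n) {U j p} → IsPath G j p → All (_∈ᵇ U) p → BPath (adjacency G) U j p
isPath⇒bpath G path p⊆U = bpath (IsPath.len path) (IsPath.distinct path) p⊆U
                                (consecutive⇒linked G (IsPath.adjacent path))

bpath⇒isPath : ∀ {n} (G : Graph n) {U j p} → BPath (adjacency G) U j p → IsPath G j p
bpath⇒isPath G (bpath len distinct _ link) =
  record { len = len ; distinct = distinct ; adjacent = linked⇒consecutive G link }

complement : ∀ {n} → Pred𝔹 n → Subset n
complement U = Vec.tabulate (not ∘ U)

∣tabulate∣ : ∀ {N} (R : Pred𝔹 N) → ∣ Vec.tabulate R ∣ ≡ count R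
∣tabulate∣ {zero}  R = refl
∣tabulate∣ {suc N} R with R zero
... | true  = cong suc (∣tabulate∣ (R ∘ suc))
... | false = ∣tabulate∣ (R ∘ suc)

∣complement∣ : ∀ {n} (U : Pred𝔹 n) → ∣ complement U ∣ ≡ n ∸ count U
∣complement∣ U = trans (∣tabulate∣ (not ∘ U)) (count-not U)

∉complement : ∀ {n} (U : Pred𝔹 n) {x} → ¬ (x ∈ˢ complement U) → x ∈ᵇ U
∉complement U {x} x∉ with U x in Ux
... | true  = refl
... | false = ⊥-elim (x∉ (lookup⇒[]= x _ (trans (lookup∘tabulate (not ∘ U) x) (cong not Ux))))

complement-covers : ∀ {n} (G : Graph n) {j} (U : Pred𝔹 n) →
                    (∀ {p} → IsPath G j p → All (_∈ᵇ U) p → ⊥) →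
                    IsKPathVertexCover G j (complement U)
complement-covers G U no-path p path with any? (_∈ˢ? complement U) p
... | yes hit  = hit
... | no  miss = ⊥-elim (no-path path (All.map (∉complement U) (Allₚ.¬Any⇒All¬ p miss)))

ψ-extremal⇒traceable : ∀ {n} (G : Graph n) j → ψ≡ G j (n ∸ j + 1) → AllSetsTraceable (adjacency G) j
ψ-extremal⇒traceable {n} G j (_ , minimal) U |U|≡j with hasPath (adjacency G) U j in found
... | true  = refl
... | false = ⊥-elim (1+n≰n (subst₂ _≤_ (+-comm (n ∸ j) 1) small (minimal (complement U) covers)))
  where
  covers : IsKPathVertexCover G j (complement U)
  covers = complement-covers G U λ path p⊆U →
    false≢true (trans (sym found) (hasPath-complete _ U (isPath⇒bpath G path p⊆U)))
  small : ∣ complement U ∣ ≡ n ∸ j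
  small = trans (∣complement∣ U) (cong (n ∸_) |U|≡j)

cover-misses-few : ∀ {n} (G : Graph n) j S → AllSetsTraceable (adjacency G) j →
                   IsKPathVertexCover G j S → ¬ (j ≤ n ∸ ∣ S ∣)
cover-misses-few {n} G j S traceable cover j≤uncovered =
  let U , U⊆uncovered , |U|≡j = subsetOfSize outside j (subst (j ≤_) (sym |outside|) j≤uncovered)
      p , path              = hasPath-sound (adjacency G) U j (traceable U |U|≡j)
      x∈U , x∈S             = All.lookupAny (BPath.inside path) (cover p (bpath⇒isPath G path))
  in false≢true (trans (sym (cong not ([]=⇒lookup x∈S))) (U⊆uncovered x∈U))
  where
  outside : Pred𝔹 n
  outside = not ∘ Vec.lookup S
  |outside| : count outside ≡ n ∸ ∣ S ∣
  |outside| = trans (count-not (Vec.lookup S)) (cong (n ∸_) (sym |S|))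
    where
    |S| : ∣ S ∣ ≡ count (Vec.lookup S)
    |S| = trans (cong ∣_∣ (sym (tabulate∘lookup S))) (∣tabulate∣ (Vec.lookup S))

∸-swap : ∀ {n j s} → j ≤ n → s ≤ n ∸ j → j ≤ n ∸ s
∸-swap {n} {s = s} j≤n s≤n∸j = subst (_≤ n ∸ s) (m∸[m∸n]≡n j≤n) (∸-monoʳ-≤ n s≤n∸j)

∸-peel : ∀ {n j} → j < n → n ∸ j ≡ n ∸ suc j + 1
∸-peel {suc n} {j} (s≤s j≤n) = trans (+-∸-assoc 1 j≤n) (+-comm 1 (n ∸ j))

traceable⇒ψ-extremal : ∀ {n} (G : Graph n) j → 0 < j → j ≤ n →
                       AllSetsTraceable (adjacency G) j → ψ≡ G j (n ∸ j + 1)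
traceable⇒ψ-extremal {n} G (suc j) _ j<n traceable = (complement V , covers , size) , lower-bound
  where
  chosen : Σ (Pred𝔹 n) λ U → (∀ {x} → x ∈ᵇ U → x ∈ᵇ full) × count U ≡ j
  chosen = subsetOfSize full j (subst (j ≤_) (sym (count-full n)) (<⇒≤ j<n))
  V : Pred𝔹 n
  V = proj₁ chosen
  |V|≡j : count V ≡ j
  |V|≡j = proj₂ (proj₂ chosen)
  covers : IsKPathVertexCover G (suc j) (complement V)
  covers = complement-covers G V λ path p⊆V →
    1+n≰n (subst₂ _≤_ (IsPath.len path) |V|≡j (length≤count (IsPath.distinct path) p⊆V))
  size : ∣ complement V ∣ ≡ n ∸ suc j + 1
  size = trans (∣complement∣ V) (trans (cong (n ∸_) |V|≡j) (∸-peel j<n))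
  lower-bound : ∀ S → IsKPathVertexCover G (suc j) S → n ∸ suc j + 1 ≤ ∣ S ∣
  lower-bound S cover with n ∸ suc j + 1 ≤? ∣ S ∣
  ... | yes large = large
  ... | no  small = ⊥-elim (cover-misses-few G (suc j) S traceable cover (∸-swap j<n
                      (m<1+n⇒m≤n (subst (∣ S ∣ <_) (+-comm (n ∸ suc j) 1) (≰⇒> small)))))

mainTheorem13 : ∀ (n : ℕ) (G : Graph n) (k : ℕ)
    → 3 ≤ n → n ≤ 7 → 2 ≤ k → k < n
    → ψ≡ G k (n ∸ k + 1)
    → ∀ (j : ℕ) → k < j → j ≤ n → ψ≡ G j (n ∸ j + 1)
mainTheorem13 n G k _ n≤7 2≤k _ ψₖ j k<j j≤n =
  traceable⇒ψ-extremal G j (≤-trans (s≤s z≤n) k<j) j≤n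
    (traceable-upward (adjacency-sym G) 2≤k (≤⇒≤′ (<⇒≤ k<j)) (≤-trans j≤n n≤7)
      (ψ-extremal⇒traceable G k ψₖ))
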